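{- Let $G$, $L$, $f_0$ and the encoding graphs $E_1,\dots,E_n$ be as in the context. Then $|V(E_1)|\le 2$, and $|V(E_i)|\le|V(E_{i-1})|+d(v_i)$ for every $i\in\{2,\dots,n\}$, where $d(v_i)$ is the degree of $v_i$ in $G$. In particular $|V(E_n)|=O(n)$.
   Context: A caterpillar is a tree $G$ whose vertex set partitions into $V_S$ (spine vertices) and $V_L$ (leaves) such that $G[V_S]$ is a path and each vertex of $V_L$ is adjacent to exactly one vertex of $V_S$. Standing assumptions: $G$ is a connected caterpillar on $n$ vertices, the two endpoints of the spine path have degree one in $G$, and each vertex $v$ has a list $L(v)$ of colors with $2\le|L(v)|\le d(v)+1$. The vertices are ordered $v_1,\dots,v_n$ by breadth-first search starting at an endpoint of the spine path, giving priority to leaves: when a spine vertex is visited, all its leaves are visited next, and then the next unvisited spine vertex. Let $V_i=\{v_1,\dots,v_i\}$, $G_i=G[V_i]$, and let $\sigma_i$ be the latest spine vertex in $V_i$ (i.e. $\sigma_i=v_i$ if $v_i$ is a spine vertex, and otherwise the unique neighbor of $v_i$). A $k$-list coloring of $G_i$ is a proper coloring $g$ of $G_i$ with $g(v)\in L(v)$; $R(G_i,L)$ is the graph whose nodes are the $k$-list colorings of $G_i$, two adjacent iff they differ on exactly one vertex. Fix a $k$-list coloring $f_0$ of $G$ and let $R_0(G_i)$ be the connected component of $R(G_i,L)$ containing the restriction $f_0[V_i]$. For nodes $g,g'$ of $R_0(G_i)$ with $g(\sigma_i)=g'(\sigma_i)$, write $g\sim g'$ if $R_0(G_i)$ contains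 a path from $g$ to $g'$ all of whose nodes assign the same color $g(\sigma_i)$ to $\sigma_i$; this is an equivalence relation. The encoding graph $E_i$ is obtained from $R_0(G_i)$ by contracting each equivalence class of $\sim$ into a single node (two classes adjacent iff some colorings in them are adjacent in $R_0(G_i)$). -}

module Defs where

open import Data.Nat using (ℕ; zero; suc; _≤_; _<_; _<ᵇ_; _+_; _*_)
open import Data.Bool using (Bool; true; false; _∧_; _∨_; not; if_then_else_)
open import Data.Fin using (Fin; zero; toℕ; fromℕ; inject₁; inject≤; fromℕ<)
open import Data.List using (List; length; filterᵇ; map; allFin)
open import Data.Bool.ListAction using (and)
open import Data.List.Membership.Propositional using (_∈_)
open import Data.List.Relation.Unary.All using (All)
open import Data.List.Relation.Unary.Any using (Any)
open import Data.List.Relation.Unary.AllPairs using (AllPairs)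
open import Data.List.Relation.Unary.Unique.Propositional using (Unique)
open import Data.Vec using (Vec; lookup; tabulate)
open import Data.Product using (Σ; _×_)
open import Relation.Binary.PropositionalEquality using (_≡_; _≢_)
open import Relation.Binary.Construct.Closure.ReflexiveTransitive using (Star)
open import Relation.Nullary using (¬_)
open import Function using (_∘_)

-- The vertices of G are Fin n, numbered v₁,…,vₙ in the BFS order of the
-- paper (v_i is the Fin element with toℕ = i - 1).  The caterpillar is
-- described by the predicate  isSpine : Fin n → Bool  (V_S = spine vertices).
-- In a BFS order started at a spine endpoint, giving priority to leaves,
-- every vertex v other than v₁ has exactly one earlier neighbour, namely
-- the latest spine vertex before it (for a spine vertex: its predecessor on
-- the spine path; for a leaf: its unique spine neighbour).  So
--   u < v are adjacent  iff  u is a spine vertex and no spine vertex lies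
--   strictly between u and v.

module _ {n : ℕ} (isSpine : Fin n → Bool) where

  noSpineBetween : Fin n → Fin n → Bool
  noSpineBetween u v =
    and (map (λ w → not ((toℕ u <ᵇ toℕ w) ∧ (toℕ w <ᵇ toℕ v) ∧ isSpine w)) (allFin n))

  back : Fin n → Fin n → Bool
  back u v = (toℕ u <ᵇ toℕ v) ∧ isSpine u ∧ noSpineBetween u v

  adj : Fin n → Fin n → Bool
  adj u v = back u v ∨ back v u

  deg : Fin n → ℕ
  deg v = length (filterᵇ (adj v) (allFin n))

  record IsBFSCaterpillar : Set where
    field
      first : Fin n
      first-is-zero : toℕ first ≡ 0
      first-spine : isSpine first ≡ true
      first-deg : deg first ≡ 1
      last-deg : ∀ (s : Fin n) → isSpine s ≡ true →
                 (∀ (w : Fin n) → toℕ s < toℕ w → isSpine w ≡ false) →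
                 deg s ≡ 1

-- latest index (≤ top) satisfying p, or zero if none
latest : ∀ {m} (p : Fin (suc m) → Bool) → Fin (suc m)
latest {zero} p = zero
latest {suc m} p with p (fromℕ (suc m))
... | true = fromℕ (suc m)
... | false = inject₁ (latest {m} (p ∘ inject₁))

module _ {n : ℕ} (isSpine : Fin n → Bool) (L : Fin n → List ℕ) where

  record AdmissibleLists : Set where
    field
      unique : ∀ v → Unique (L v)
      lower  : ∀ v → 2 ≤ length (L v)
      upper  : ∀ v → length (L v) ≤ deg isSpine v + 1

  IsListColouring : (Fin n → ℕ) → Set
  IsListColouring f =
    (∀ v → f v ∈ L v) × (∀ u v → adj isSpine u v ≡ true → f u ≢ f v)

  module _ (f₀ : Fin n → ℕ) where

    -- G_i with i = suc m vertices v₁,…,v_i (requires i ≤ n).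
    -- Colourings of G_i are vectors of length i (position j ↦ colour of v_{j+1}).
    module _ (m : ℕ) (i≤n : suc m ≤ n) where

      emb : Fin (suc m) → Fin n
      emb j = inject≤ j i≤n

      Colouring : Set
      Colouring = Vec ℕ (suc m)

      Valid : Colouring → Set
      Valid g = (∀ j → lookup g j ∈ L (emb j)) ×
                (∀ j j' → adj isSpine (emb j) (emb j') ≡ true → lookup g j ≢ lookup g j')

      DiffOne : Colouring → Colouring → Set
      DiffOne g h = Σ (Fin (suc m)) λ j →
        (lookup g j ≢ lookup h j) × (∀ j' → j' ≢ j → lookup g j' ≡ lookup h j')

      Step : Colouring → Colouring → Set
      Step g h = Valid g × Valid h × DiffOne g h

      f₀↾ : Colouring
      f₀↾ = tabulate (λ j → f₀ (emb j))

      InR₀ : Colouring → Set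
      InR₀ g = Star Step f₀↾ g

      σ : Fin (suc m)
      σ = latest (isSpine ∘ emb)

      Equiv : Colouring → Colouring → Set
      Equiv g h = InR₀ g × InR₀ h × (lookup g σ ≡ lookup h σ) ×
        Star (λ a b → Step a b × lookup a σ ≡ lookup g σ × lookup b σ ≡ lookup g σ) g h

      -- |V(E_i)| = c : there are c nodes of R₀(G_i), pairwise in different
      -- ∼-classes, meeting every ∼-class (a choice of one representative per
      -- node of the encoding graph E_i).
      NodeCount : ℕ → Set
      NodeCount c = Σ (List Colouring) λ xs →
        (length xs ≡ c) × All InR₀ xs × AllPairs (λ a b → ¬ Equiv a b) xs ×
        (∀ g → InR₀ g → Any (Equiv g) xs)

{-# OPTIONS --safe #-}
module Submission where

-- Write a colouring of G_{i+1} as g ∷ʳ z with g a colouring of G_i. As σ_i is the only earlier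
-- neighbour of v_{i+1}, g ∷ʳ z is proper iff g is and z ∈ L(v_{i+1}) differs from g(σ_i), and
-- forgetting z maps walks in R(G_{i+1}) to walks in R(G_i).
-- If v_{i+1} is a leaf then σ_{i+1} = σ_i: a walk inside a class of E_i lifts with z fixed, and one
-- recolouring of v_{i+1} then reaches a chosen representative, so |E_{i+1}| ≤ |E_i|.
-- If v_{i+1} is on the spine then σ_{i+1} = v_{i+1}, and g ∷ʳ z ∼ h ∷ʳ z whenever g and h are joined
-- by a walk along which σ_i avoids the colour z. Fix a breadth-first tree of E_i rooted at the class
-- of f₀ and climb from the class of g towards the root while the colour of σ_i differs from z: the
-- climb stops at the root or just below a class of colour z. Hence the classes t ≠ root, extended by
-- the colour of their parent, and the root class, extended by each z ∈ L(v_{i+1}), represent every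
-- class of E_{i+1}: at most (|E_i| - 1) + (d(v_{i+1}) + 1) of them.
-- Summing up, |E_i| ≤ 2 + Σ_v d(v) ≤ 2 + 2n ≤ 4n, since every vertex has at most one earlier neighbour.
-- Equivalence of colourings is not decidable, so representatives are chosen under double negation;
-- this is harmless because every conclusion is a decidable inequality.

open import Defs hiding (Colouring; emb; Valid; DiffOne; Step; f₀↾; InR₀; σ; Equiv)
import Defs as D

import Algebra.Properties.CommutativeMonoid.Sum as Sum
open import Data.Bool using (Bool; true; false; _∧_; _∨_; if_then_else_)
open import Data.Bool.Properties using (T-≡; T-not-≡; ∨-comm)
open import Data.Empty using (⊥-elim)
open import Data.Fin using (Fin; zero; suc; _≟_; toℕ; fromℕ; fromℕ<; inject₁; inject≤; punchIn; punchOut)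
  renaming (_<_ to _<ᶠ_)
open import Data.Fin.Properties
  using (any?; pigeonhole; toℕ-injective; suc-injective; toℕ-inject₁; toℕ-inject≤; ≤fromℕ; toℕ-fromℕ;
         toℕ-fromℕ<; toℕ<n; inject₁-injective; fromℕ≢inject₁; punchIn-punchOut)
  renaming (<-cmp to <ᶠ-cmp)
open import Data.Fin.Relation.Unary.Top using (view; ‵fromℕ; ‵inject₁)
open import Data.List as List using (List; []; _∷_; length; filterᵇ; allFin; _++_)
open import Data.List.Membership.Propositional using (_∈_; lose)
open import Data.List.Membership.Propositional.Properties using (∈-lookup; ∈-allFin; ∈-map⁺; ∈-++⁺ˡ; ∈-++⁺ʳ)
open import Data.List.Properties using (length-map; length-tabulate; length-++)
open import Data.List.Relation.Unary.All as All using (All; []; _∷_)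
open import Data.List.Relation.Unary.All.Properties using (¬Any⇒All¬; all⁺; all⁻)
open import Data.List.Relation.Unary.AllPairs using (AllPairs; []; _∷_)
open import Data.List.Relation.Unary.Any as Any using (Any; here; there; index)
open import Data.List.Relation.Unary.Any.Properties using (lookup-index; map⁺)
open import Data.List.Relation.Unary.Unique.Propositional using (Unique)
open import Data.Nat as ℕ using (ℕ; zero; suc; _≤_; _<_; _+_; _*_; z≤n; s≤s; _<ᵇ_; _≤?_)
open import Data.Nat.Properties
  using (≮⇒≥; ≤-refl; ≤-reflexive; ≤-trans; <-≤-trans; ≤-pred; ≤-antisym; n<1+n; n≤1+n; m≤m+n;
         m<1+n⇒m<n∨m≡n; <⇒≱; <⇒≯; <-irrefl; <-cmp; <ᵇ⇒<; <⇒<ᵇ; +-suc; +-comm; +-assoc; +-identityʳ;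
         +-mono-≤; +-monoˡ-≤; +-monoʳ-≤; +-0-commutativeMonoid; module ≤-Reasoning)
open import Data.Nat.Tactic.RingSolver using (solve-∀)
open import Data.Product using (Σ; ∃-syntax; _×_; _,_; proj₁; proj₂)
open import Data.Sum using (_⊎_; inj₁; inj₂)
open import Data.Vec using (Vec; []; _∷_; lookup; tabulate; _∷ʳ_; init; initLast)
open import Data.Vec.Properties using (tabulate∘lookup; tabulate-cong; lookup∘tabulate; init-∷ʳ)
open import Effect.Monad using (RawMonad)
open import Function using (_∘_; id; Equivalence)
open import Level using (0ℓ)
open import Relation.Binary.Construct.Closure.ReflexiveTransitive using (Star; ε; _◅_; _◅◅_; gmap; reverse)
open import Relation.Binary.Definitions using (Symmetric; Transitive; tri<; tri≈; tri>)
open import Relation.Binary.PropositionalEquality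
  using (_≡_; _≢_; refl; sym; trans; cong; cong₂; subst; subst₂)
open import Relation.Nullary using (¬_; Dec; yes; no)
open import Relation.Nullary.Decidable using (_×-dec_; _⊎-dec_; ¬?; ¬¬-excluded-middle; decidable-stable)
open import Relation.Nullary.Negation using (¬¬-Monad)
open import Relation.Unary using (Decidable)

open Sum +-0-commutativeMonoid using (sum-syntax; ∑-comm; ∑-distrib-+; sum-init-last; sum-cong-≗)
open RawMonad (¬¬-Monad {0ℓ}) using (_>>=_; _<$>_; return)
open Equivalence using (to; from)

¬¬-Π : ∀ {N} {P : Fin N → Set} → (∀ i → ¬ ¬ P i) → ¬ ¬ (∀ i → P i)
¬¬-Π {zero} _ = return λ ()
¬¬-Π {suc N} h = do
  p₀ ← h zero
  ps ← ¬¬-Π (h ∘ suc)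
  return λ { zero → p₀ ; (suc i) → ps i }

module _ {P : ℕ → Set} (P? : Decidable P) where

  least : ∀ {ℓ} → P ℓ → ∃[ k ] P k × (∀ {k′} → k′ < k → ¬ P k′)
  least {ℓ} p = search ℓ 0 (λ ()) (subst P (sym (+-identityʳ ℓ)) p)
    where
    search : ∀ fuel k → (∀ {k′} → k′ < k → ¬ P k′) → P (fuel + k) →
             ∃[ k ] P k × (∀ {k′} → k′ < k → ¬ P k′)
    search zero k below p = k , p , below
    search (suc fuel) k below p with P? k
    ... | yes pk = k , pk , below
    ... | no ¬pk = search fuel (suc k) below′ (subst P (sym (+-suc fuel k)) p)
      where
      below′ : ∀ {k′} → k′ < suc k → ¬ P k′
      below′ k′<1+k with m<1+n⇒m<n∨m≡n k′<1+k
      ... | inj₁ k′<k = below k′<k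
      ... | inj₂ refl = ¬pk

AllPairs-lookup : ∀ {X : Set} {R : X → X → Set} {xs : List X} → AllPairs R xs →
                  ∀ {i j} → i <ᶠ j → R (List.lookup xs i) (List.lookup xs j)
AllPairs-lookup (Rx ∷ _) {zero} {suc j} _ = All.lookup Rx (∈-lookup j)
AllPairs-lookup (_ ∷ Rxs) {suc i} {suc j} (s≤s i<j) = AllPairs-lookup Rxs i<j

module Transversal {X : Set} (P : X → Set) (_∼_ : X → X → Set)
  (∼-sym : Symmetric _∼_) (∼-trans : Transitive _∼_) (∼⇒P : ∀ {x y} → x ∼ y → P y) where

  Inequivalent : List X → Set
  Inequivalent = AllPairs (λ x y → ¬ x ∼ y)

  Covers : List X → Set
  Covers ys = ∀ x → P x → Any (x ∼_) ys

  inequivalent-length≤ : ∀ {xs ys} → All P xs → Inequivalent xs → Covers ys → length xs ≤ length ys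
  inequivalent-length≤ {xs} {ys} Pxs ineq cover = ≮⇒≥ λ ys<xs →
    let i , j , i<j , same = pigeonhole ys<xs (index ∘ hit) in
    AllPairs-lookup ineq i<j (∼-trans (lookup-index (hit i))
      (∼-sym (subst (λ k → List.lookup xs j ∼ List.lookup ys k) (sym same) (lookup-index (hit j)))))
    where
    hit : ∀ i → Any (List.lookup xs i ∼_) ys
    hit i = cover _ (All.lookup Pxs (∈-lookup i))

  ¬¬-transversal : ∀ ys → ¬ ¬ (∃[ xs ] All P xs × Inequivalent xs ×
                                       (∀ {x} → Any (x ∼_) ys → Any (x ∼_) xs))
  ¬¬-transversal [] = return ([] , [] , [] , λ ())
  ¬¬-transversal (y ∷ ys) = do
    xs , Pxs , ineq , keep ← ¬¬-transversal ys
    P? ← ¬¬-excluded-middle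
    represented? ← ¬¬-excluded-middle
    return (insert Pxs ineq keep P? represented?)
    where
    insert : ∀ {xs} → All P xs → Inequivalent xs → (∀ {x} → Any (x ∼_) ys → Any (x ∼_) xs) →
             Dec (P y) → Dec (Any (y ∼_) xs) →
             ∃[ xs′ ] All P xs′ × Inequivalent xs′ × (∀ {x} → Any (x ∼_) (y ∷ ys) → Any (x ∼_) xs′)
    insert {xs} Pxs ineq keep (no ¬Py) _ = xs , Pxs , ineq , λ
      { (here x∼y) → ⊥-elim (¬Py (∼⇒P x∼y)) ; (there x∼ys) → keep x∼ys }
    insert {xs} Pxs ineq keep (yes _) (yes y∼xs) = xs , Pxs , ineq , λ
      { (here x∼y) → Any.map (∼-trans x∼y) y∼xs ; (there x∼ys) → keep x∼ys }
    insert {xs} Pxs ineq keep (yes Py) (no y≁xs) = y ∷ xs , Py ∷ Pxs , ¬Any⇒All¬ xs y≁xs ∷ ineq , λ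
      { (here x∼y) → here x∼y ; (there x∼ys) → there (keep x∼ys) }

module BreadthFirstTree {N : ℕ} (A : Fin N → Fin N → Set) (A? : ∀ u v → Dec (A u v)) (root : Fin N) where

  Within : ℕ → Fin N → Set
  Within zero v = v ≡ root
  Within (suc k) v = Within k v ⊎ ∃[ u ] Within k u × A u v

  within? : ∀ k v → Dec (Within k v)
  within? zero v = v ≟ root
  within? (suc k) v = within? k v ⊎-dec any? (λ u → within? k u ×-dec A? u v)

  Star⇒Within : ∀ {k u v} → Within k u → Star A u v → ∃[ k′ ] Within k′ v
  Star⇒Within {k} w ε = k , w
  Star⇒Within {k} {u} w (a ◅ walk) = Star⇒Within {suc k} (inj₂ (u , w , a)) walk

  module Tree (connected : ∀ v → Star A root v) where

    private
      shortest : ∀ v → ∃[ k ] Within k v × (∀ {k′} → k′ < k → ¬ Within k′ v)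
      shortest v = least (λ k → within? k v) (proj₂ (Star⇒Within {0} refl (connected v)))

    depth : Fin N → ℕ
    depth v = proj₁ (shortest v)

    depth-minimal : ∀ {k v} → Within k v → depth v ≤ k
    depth-minimal {k} {v} w = ≮⇒≥ λ k<depth → proj₂ (proj₂ (shortest v)) k<depth w

    private
      closer : ∀ {k v} → Within k v → (∀ {k′} → k′ < k → ¬ Within k′ v) → v ≢ root →
               ∃[ u ] A u v × depth u < k
      closer {zero} v≡root _ v≢root = ⊥-elim (v≢root v≡root)
      closer {suc k} (inj₁ w) minimal _ = ⊥-elim (minimal (n<1+n k) w)
      closer {suc k} (inj₂ (u , w , a)) _ _ = u , a , s≤s (depth-minimal w)

      closer-neighbour : ∀ {v} → v ≢ root → ∃[ u ] A u v × depth u < depth v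
      closer-neighbour {v} = let _ , w , minimal = shortest v in closer w minimal

    parent : Fin N → Fin N
    parent v with v ≟ root
    ... | yes _ = root
    ... | no v≢root = proj₁ (closer-neighbour v≢root)

    parent-spec : ∀ {v} → v ≢ root → A (parent v) v × depth (parent v) < depth v
    parent-spec {v} v≢root with v ≟ root
    ... | yes v≡root = ⊥-elim (v≢root v≡root)
    ... | no v≢root′ = proj₂ (closer-neighbour v≢root′)

    Up : (Fin N → Set) → Fin N → Fin N → Set
    Up Q v u = A u v × Q v × Q u

    climb : ∀ {Q : Fin N → Set} → Decidable Q → ∀ {v} → Q v →
            ∃[ t ] Star (Up Q) v t × (t ≡ root ⊎ ¬ Q (parent t))
    climb {Q} Q? {v} = go (suc (depth v)) v ≤-refl
      where
      go : ∀ fuel v → depth v < fuel → Q v → ∃[ t ] Star (Up Q) v t × (t ≡ root ⊎ ¬ Q (parent t))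
      go zero _ () _
      go (suc fuel) v depth<fuel qv with v ≟ root
      ... | yes v≡root = v , ε , inj₁ v≡root
      ... | no v≢root with Q? (parent v)
      ...   | no ¬qp = v , ε , inj₂ ¬qp
      ...   | yes qp =
        let a , nearer = parent-spec v≢root
            t , walk , stop = go fuel (parent v) (<-≤-trans nearer (≤-pred depth<fuel)) qp
        in t , (a , qv , qp) ◅ walk , stop

indicator : Bool → ℕ
indicator b = if b then 1 else 0

indicator-∨ : ∀ a b → indicator (a ∨ b) ≤ indicator a + indicator b
indicator-∨ true _ = s≤s z≤n
indicator-∨ false _ = ≤-refl

∑-mono-≤ : ∀ {k} {f g : Fin k → ℕ} → (∀ i → f i ≤ g i) → ∑[ i < k ] f i ≤ ∑[ i < k ] g i
∑-mono-≤ {zero} _ = z≤n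
∑-mono-≤ {suc k} f≤g = +-mono-≤ (f≤g zero) (∑-mono-≤ (f≤g ∘ suc))

∑-const-1 : ∀ k → ∑[ i < k ] 1 ≡ k
∑-const-1 zero = refl
∑-const-1 (suc k) = cong suc (∑-const-1 k)

∑-indicator-false : ∀ {k} (P : Fin k → Bool) → (∀ i → P i ≡ false) → ∑[ i < k ] indicator (P i) ≡ 0
∑-indicator-false {zero} _ _ = refl
∑-indicator-false {suc k} P none rewrite none zero = ∑-indicator-false (P ∘ suc) (none ∘ suc)

∑-indicator-unique : ∀ {k} (P : Fin k → Bool) → (∀ {i j} → P i ≡ true → P j ≡ true → i ≡ j) →
                     ∑[ i < k ] indicator (P i) ≤ 1
∑-indicator-unique {zero} _ _ = z≤n
∑-indicator-unique {suc k} P unique with P zero in P₀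
... | false = ∑-indicator-unique (P ∘ suc) (λ Pi Pj → suc-injective (unique Pi Pj))
... | true = s≤s (≤-reflexive (∑-indicator-false (P ∘ suc) none))
  where
  none : ∀ i → P (suc i) ≡ false
  none i with P (suc i) in Pᵢ
  ... | false = refl
  ... | true with () ← unique P₀ Pᵢ

length-filterᵇ-tabulate : ∀ {X : Set} {k} (p : X → Bool) (f : Fin k → X) →
                          length (filterᵇ p (List.tabulate f)) ≡ ∑[ i < k ] indicator (p (f i))
length-filterᵇ-tabulate {k = zero} _ _ = refl
length-filterᵇ-tabulate {k = suc k} p f with p (f zero)
... | true = cong suc (length-filterᵇ-tabulate p (f ∘ suc))
... | false = length-filterᵇ-tabulate p (f ∘ suc)

module CaterpillarAdjacency {n : ℕ} (isSpine : Fin n → Bool) where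

  NoSpineBetween : Fin n → Fin n → Set
  NoSpineBetween u v = ∀ w → toℕ u < toℕ w → toℕ w < toℕ v → isSpine w ≡ false

  noSpineBetween⇒ : ∀ {u v} → noSpineBetween isSpine u v ≡ true → NoSpineBetween u v
  noSpineBetween⇒ {u} {v} none w u<w w<v =
    subst₂ (λ a b → a ∧ b ∧ isSpine w ≡ false) (to T-≡ (<⇒<ᵇ u<w)) (to T-≡ (<⇒<ᵇ w<v))
      (to T-not-≡ (All.lookup (all⁺ _ (allFin n) (from T-≡ none)) (∈-allFin w)))

  ⇒noSpineBetween : ∀ {u v} → NoSpineBetween u v → noSpineBetween isSpine u v ≡ true
  ⇒noSpineBetween {u} {v} none = to T-≡ (all⁻ _ {xs = allFin n} (All.tabulate λ {w} _ → from T-not-≡ (no-spine w)))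
    where
    no-spine : ∀ w → ((toℕ u <ᵇ toℕ w) ∧ (toℕ w <ᵇ toℕ v) ∧ isSpine w) ≡ false
    no-spine w with toℕ u <ᵇ toℕ w in u<w | toℕ w <ᵇ toℕ v in w<v
    ... | false | _ = refl
    ... | true | false = refl
    ... | true | true = none w (<ᵇ⇒< _ _ (from T-≡ u<w)) (<ᵇ⇒< _ _ (from T-≡ w<v))

  back⇒ : ∀ {u v} → back isSpine u v ≡ true →
          toℕ u < toℕ v × isSpine u ≡ true × NoSpineBetween u v
  back⇒ {u} {v} e with toℕ u <ᵇ toℕ v in u<v | isSpine u
  ... | true | true = <ᵇ⇒< _ _ (from T-≡ u<v) , refl , noSpineBetween⇒ e

  ⇒back : ∀ {u v} → toℕ u < toℕ v → isSpine u ≡ true → NoSpineBetween u v → back isSpine u v ≡ true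
  ⇒back u<v spine none rewrite to T-≡ (<⇒<ᵇ u<v) | spine = ⇒noSpineBetween none

  latestSpine⇒back : ∀ {u v} → toℕ u < toℕ v → isSpine u ≡ true →
                     (∀ w → isSpine w ≡ true → toℕ w < toℕ v → toℕ w ≤ toℕ u) → back isSpine u v ≡ true
  latestSpine⇒back {u} {v} u<v spine latest = ⇒back u<v spine between
    where
    between : NoSpineBetween u v
    between w u<w w<v with isSpine w in spine-w
    ... | false = refl
    ... | true = ⊥-elim (<⇒≱ u<w (latest w spine-w w<v))

  private
    back-≮ : ∀ {u u′ v} → back isSpine u v ≡ true → back isSpine u′ v ≡ true → ¬ toℕ u < toℕ u′
    back-≮ {u} {u′} {v} b b′ u<u′ with back⇒ {u} {v} b | back⇒ {u′} {v} b′
    ... | _ , _ , none | u′<v , spine′ , _ with () ← trans (sym (none _ u<u′ u′<v)) spine′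

  back-unique : ∀ {u u′ v} → back isSpine u v ≡ true → back isSpine u′ v ≡ true → u ≡ u′
  back-unique {u} {u′} {v} b b′ with <-cmp (toℕ u) (toℕ u′)
  ... | tri< u<u′ _ _ = ⊥-elim (back-≮ {v = v} b b′ u<u′)
  ... | tri≈ _ u≡u′ _ = toℕ-injective u≡u′
  ... | tri> _ _ u′<u = ⊥-elim (back-≮ {v = v} b′ b u′<u)

  adj-sym : ∀ u v → adj isSpine u v ≡ adj isSpine v u
  adj-sym u v = ∨-comm (back isSpine u v) (back isSpine v u)

  adj-irrefl : ∀ v → adj isSpine v v ≢ true
  adj-irrefl v _ with back isSpine v v in b
  ... | true = <-irrefl refl (proj₁ (back⇒ {v} {v} b))

  adj⇒back : ∀ {u v} → toℕ u < toℕ v → adj isSpine u v ≡ true → back isSpine u v ≡ true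
  adj⇒back {u} {v} u<v e with back isSpine u v | back isSpine v u in b
  ... | true | _ = refl
  ... | false | true = ⊥-elim (<⇒≯ u<v (proj₁ (back⇒ {v} {u} b)))

  degree-split : ∀ v → deg isSpine v ≤
                       ∑[ u < n ] indicator (back isSpine v u) + ∑[ u < n ] indicator (back isSpine u v)
  degree-split v = begin
    deg isSpine v                             ≡⟨ length-filterᵇ-tabulate (adj isSpine v) id ⟩
    ∑[ u < n ] indicator (adj isSpine v u)    ≤⟨ ∑-mono-≤ (λ u → indicator-∨ (back isSpine v u) (back isSpine u v)) ⟩
    ∑[ u < n ] (later u + earlier u)          ≡⟨ ∑-distrib-+ later earlier ⟩
    ∑[ u < n ] later u + ∑[ u < n ] earlier u ∎
    where
    open ≤-Reasoning
    later earlier : Fin n → ℕ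
    later u = indicator (back isSpine v u)
    earlier u = indicator (back isSpine u v)

  handshake : ∑[ v < n ] deg isSpine v ≤ n + n
  handshake = begin
    ∑[ v < n ] deg isSpine v                                   ≤⟨ ∑-mono-≤ degree-split ⟩
    ∑[ v < n ] (later v + earlier v)                           ≡⟨ ∑-distrib-+ later earlier ⟩
    ∑[ v < n ] later v + ∑[ v < n ] earlier v                  ≡⟨ cong (_+ ∑[ v < n ] earlier v) (∑-comm later-edge) ⟩
    ∑[ v < n ] earlier v + ∑[ v < n ] earlier v                ≤⟨ +-mono-≤ at-most-n at-most-n ⟩
    n + n                                                      ∎
    where
    open ≤-Reasoning
    later-edge : Fin n → Fin n → ℕ
    later-edge v u = indicator (back isSpine v u)
    later earlier : Fin n → ℕ
    later v = ∑[ u < n ] later-edge v u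
    earlier v = ∑[ u < n ] later-edge u v
    at-most-n : ∑[ v < n ] earlier v ≤ n
    at-most-n = ≤-trans (∑-mono-≤ (λ v → ∑-indicator-unique (λ u → back isSpine u v) (back-unique {v = v})))
                        (≤-reflexive (∑-const-1 n))

latest-satisfies : ∀ {m} (p : Fin (suc m) → Bool) {j} → p j ≡ true → p (latest p) ≡ true
latest-satisfies {zero} p {zero} pj = pj
latest-satisfies {suc m} p {j} pj with p (fromℕ (suc m)) in top
... | true = top
... | false with view j
...   | ‵inject₁ j′ = latest-satisfies (p ∘ inject₁) pj
...   | ‵fromℕ with () ← trans (sym pj) top

latest-maximal : ∀ {m} (p : Fin (suc m) → Bool) {j} → p j ≡ true → toℕ j ≤ toℕ (latest p)
latest-maximal {zero} p {zero} _ = z≤n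
latest-maximal {suc m} p {j} pj with p (fromℕ (suc m)) in top
... | true = ≤fromℕ j
... | false with view j
...   | ‵inject₁ j′ =
  subst₂ _≤_ (sym (toℕ-inject₁ j′)) (sym (toℕ-inject₁ _)) (latest-maximal (p ∘ inject₁) pj)
...   | ‵fromℕ with () ← trans (sym pj) top

latest-unique : ∀ {m} (p : Fin (suc m) → Bool) {j} → p j ≡ true →
                (∀ {i} → p i ≡ true → toℕ i ≤ toℕ j) → latest p ≡ j
latest-unique p pj maximal = toℕ-injective (≤-antisym (maximal (latest-satisfies p pj)) (latest-maximal p pj))

lookup-∷ʳ-inject₁ : ∀ {X : Set} {k} (xs : Vec X k) x j → lookup (xs ∷ʳ x) (inject₁ j) ≡ lookup xs j
lookup-∷ʳ-inject₁ (_ ∷ _) _ zero = refl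
lookup-∷ʳ-inject₁ (_ ∷ xs) x (suc j) = lookup-∷ʳ-inject₁ xs x j

lookup-∷ʳ-fromℕ : ∀ {X : Set} {k} (xs : Vec X k) x → lookup (xs ∷ʳ x) (fromℕ k) ≡ x
lookup-∷ʳ-fromℕ [] _ = refl
lookup-∷ʳ-fromℕ (_ ∷ xs) x = lookup-∷ʳ-fromℕ xs x

tabulate-∷ʳ : ∀ {X : Set} {k} (f : Fin (suc k) → X) → tabulate f ≡ tabulate (f ∘ inject₁) ∷ʳ f (fromℕ k)
tabulate-∷ʳ {k = zero} f = refl
tabulate-∷ʳ {k = suc k} f = cong (f zero ∷_) (tabulate-∷ʳ (f ∘ suc))

lookup-extensional : ∀ {X : Set} {k} {xs ys : Vec X k} → (∀ j → lookup xs j ≡ lookup ys j) → xs ≡ ys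
lookup-extensional {xs = xs} {ys} same =
  trans (sym (tabulate∘lookup xs)) (trans (tabulate-cong same) (tabulate∘lookup ys))

∑-inject≤ : ∀ {k n} (f : Fin n → ℕ) (k≤n : k ≤ n) → ∑[ j < k ] f (inject≤ j k≤n) ≤ ∑[ i < n ] f i
∑-inject≤ {zero} _ _ = z≤n
∑-inject≤ {suc k} {suc n} f (s≤s k≤n) = +-monoʳ-≤ (f zero) (∑-inject≤ (f ∘ suc) k≤n)

allFin-except : ∀ {N} (r : Fin N) → ∃[ ts ] suc (length ts) ≡ N × (∀ {t} → t ≢ r → t ∈ ts)
allFin-except {suc N} r =
  List.map (punchIn r) (allFin N) ,
  cong suc (trans (length-map (punchIn r) (allFin N)) (length-tabulate id)) ,
  λ t≢r → subst (_∈ _) (punchIn-punchOut (t≢r ∘ sym)) (∈-map⁺ (punchIn r) (∈-allFin (punchOut (t≢r ∘ sym))))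

other-member : ∀ {xs : List ℕ} → Unique xs → 2 ≤ length xs → ∀ c → ∃[ z ] z ∈ xs × z ≢ c
other-member {a ∷ b ∷ _} ((a≢b ∷ _) ∷ _) _ c with a ℕ.≟ c
... | yes refl = b , there (here refl) , a≢b ∘ sym
... | no a≢c = a , here refl , a≢c
other-member {_ ∷ []} _ (s≤s ()) _

module Reconfiguration {n : ℕ} (isSpine : Fin n → Bool) (L : Fin n → List ℕ) (f₀ : Fin n → ℕ)
  (caterpillar : IsBFSCaterpillar isSpine) (lists : AdmissibleLists isSpine L)
  (f₀-colouring : IsListColouring isSpine L f₀) where

  open IsBFSCaterpillar caterpillar
  open AdmissibleLists lists
  open CaterpillarAdjacency isSpine

  module Prefix (m : ℕ) (p : suc m ≤ n) where

    Colouring : Set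
    Colouring = D.Colouring isSpine L f₀ m p

    emb : Fin (suc m) → Fin n
    emb = D.emb isSpine L f₀ m p

    Valid : Colouring → Set
    Valid = D.Valid isSpine L f₀ m p

    DiffOne : Colouring → Colouring → Set
    DiffOne = D.DiffOne isSpine L f₀ m p

    Step : Colouring → Colouring → Set
    Step = D.Step isSpine L f₀ m p

    f₀↾ : Colouring
    f₀↾ = D.f₀↾ isSpine L f₀ m p

    InR₀ : Colouring → Set
    InR₀ = D.InR₀ isSpine L f₀ m p

    σ : Fin (suc m)
    σ = D.σ isSpine L f₀ m p

    _∼_ : Colouring → Colouring → Set
    _∼_ = D.Equiv isSpine L f₀ m p

    EncodingSize : ℕ → Set
    EncodingSize = NodeCount isSpine L f₀ m p

    degree-sum : ℕ
    degree-sum = ∑[ j < suc m ] deg isSpine (emb j)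

    toℕ-emb : ∀ j → toℕ (emb j) ≡ toℕ j
    toℕ-emb j = toℕ-inject≤ j p

    emb-injective : ∀ {i j} → emb i ≡ emb j → i ≡ j
    emb-injective {i} {j} e = toℕ-injective (trans (sym (toℕ-emb i)) (trans (cong toℕ e) (toℕ-emb j)))

    emb-zero : emb zero ≡ first
    emb-zero = toℕ-injective (trans (toℕ-emb zero) (sym first-is-zero))

    σ-spine : isSpine (emb σ) ≡ true
    σ-spine = latest-satisfies (isSpine ∘ emb) (subst (λ v → isSpine v ≡ true) (sym emb-zero) first-spine)

    σ-maximal : ∀ {j} → isSpine (emb j) ≡ true → toℕ j ≤ toℕ σ
    σ-maximal = latest-maximal (isSpine ∘ emb)

    σ-unique : ∀ {j} → isSpine (emb j) ≡ true → (∀ {i} → isSpine (emb i) ≡ true → toℕ i ≤ toℕ j) → σ ≡ j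
    σ-unique = latest-unique (isSpine ∘ emb)

    f₀↾-valid : Valid f₀↾
    f₀↾-valid = in-lists , proper
      where
      f₀↾-lookup : ∀ j → lookup f₀↾ j ≡ f₀ (emb j)
      f₀↾-lookup = lookup∘tabulate (f₀ ∘ emb)
      in-lists : ∀ j → lookup f₀↾ j ∈ L (emb j)
      in-lists j = subst (_∈ L (emb j)) (sym (f₀↾-lookup j)) (proj₁ f₀-colouring (emb j))
      proper : ∀ j j′ → adj isSpine (emb j) (emb j′) ≡ true → lookup f₀↾ j ≢ lookup f₀↾ j′
      proper j j′ a rewrite f₀↾-lookup j | f₀↾-lookup j′ = proj₂ f₀-colouring (emb j) (emb j′) a

    Step-sym : ∀ {g h} → Step g h → Step h g
    Step-sym (vg , vh , j , g≢h , rest) = vh , vg , j , g≢h ∘ sym , λ j′ j′≢j → sym (rest j′ j′≢j)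

    InR₀⇒Valid : ∀ {g} → InR₀ g → Valid g
    InR₀⇒Valid = valid-along f₀↾-valid
      where
      valid-along : ∀ {g h} → Valid g → Star Step g h → Valid h
      valid-along vg ε = vg
      valid-along _ ((_ , vh , _) ◅ walk) = valid-along vh walk

    WalkStep : (ℕ → Set) → Colouring → Colouring → Set
    WalkStep C a b = Step a b × C (lookup a σ) × C (lookup b σ)

    Walk : (ℕ → Set) → Colouring → Colouring → Set
    Walk C = Star (WalkStep C)

    Walk⇒Star : ∀ {C g h} → Walk C g h → Star Step g h
    Walk⇒Star = gmap id proj₁

    Walk-weaken : ∀ {C C′ : ℕ → Set} {g h} → (∀ {x} → C x → C′ x) → Walk C g h → Walk C′ g h
    Walk-weaken C⇒C′ = gmap id λ (s , ca , cb) → s , C⇒C′ ca , C⇒C′ cb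

    Walk-reverse : ∀ {C g h} → Walk C g h → Walk C h g
    Walk-reverse = reverse λ {a} {b} (s , ca , cb) → Step-sym {a} {b} s , cb , ca

    Walk-colour : ∀ {c g h} → Walk (_≡ c) g h → lookup g σ ≡ c → lookup h σ ≡ c
    Walk-colour ε gc = gc
    Walk-colour ((_ , _ , bc) ◅ walk) _ = Walk-colour walk bc

    ∼-intro : ∀ {g h} → InR₀ g → Walk (_≡ lookup g σ) g h → g ∼ h
    ∼-intro {g} ig walk = ig , ig ◅◅ Walk⇒Star {C = _≡ lookup g σ} walk , sym (Walk-colour walk refl) , walk

    ∼-refl : ∀ {g} → InR₀ g → g ∼ g
    ∼-refl ig = ∼-intro ig ε

    ∼⇒Walk : ∀ {g h} → g ∼ h → Walk (_≡ lookup g σ) g h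
    ∼⇒Walk (_ , _ , _ , walk) = walk

    ∼⇒InR₀ : ∀ {g h} → g ∼ h → InR₀ h
    ∼⇒InR₀ (_ , ih , _ , _) = ih

    ∼-colour : ∀ {g h} → g ∼ h → lookup g σ ≡ lookup h σ
    ∼-colour (_ , _ , same , _) = same

    ∼-sym : Symmetric _∼_
    ∼-sym {g} {h} g∼h = ∼-intro (∼⇒InR₀ g∼h)
      (subst (λ c → Walk (_≡ c) h g) (∼-colour g∼h) (Walk-reverse {C = _≡ lookup g σ} (∼⇒Walk g∼h)))

    ∼-trans : Transitive _∼_
    ∼-trans {g} {h} {k} g∼h h∼k =
      ∼-intro (proj₁ g∼h)
        (∼⇒Walk g∼h ◅◅ subst (λ c → Walk (_≡ c) h k) (sym (∼-colour g∼h)) (∼⇒Walk h∼k))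

    ∼⇒Walk-avoiding : ∀ {g h z} → g ∼ h → z ≢ lookup g σ → Walk (z ≢_) g h
    ∼⇒Walk-avoiding {g} g∼h z≢ =
      Walk-weaken {C = _≡ lookup g σ} (λ x≡ z≡x → z≢ (trans z≡x x≡)) (∼⇒Walk g∼h)

    open Transversal InR₀ _∼_ ∼-sym ∼-trans ∼⇒InR₀ public

    Covered : ℕ → Set
    Covered k = ∃[ ys ] length ys ≤ k × Covers ys

    Covered-weaken : ∀ {k k′} → k ≤ k′ → Covered k → Covered k′
    Covered-weaken k≤k′ (ys , ys≤k , cover) = ys , ≤-trans ys≤k k≤k′ , cover

    size-covered : ∀ {c} → EncodingSize c → Covered c
    size-covered (xs , length≡c , _ , _ , cover) = xs , ≤-reflexive length≡c , cover

    size≤cover : ∀ {c k} → EncodingSize c → Covered k → c ≤ k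
    size≤cover (_ , refl , In-xs , ineq , _) (_ , ys≤k , cover) = ≤-trans (inequivalent-length≤ In-xs ineq cover) ys≤k

    ¬¬-size : ∀ {k} → Covered k → ¬ ¬ (∃[ c ] EncodingSize c × c ≤ k)
    ¬¬-size (ys , ys≤k , cover) = do
      xs , In-xs , ineq , keep ← ¬¬-transversal ys
      let size = xs , refl , In-xs , ineq , λ g ig → keep (cover g ig)
      return (length xs , size , size≤cover size (ys , ys≤k , cover))

  base-covered : (p : 1 ≤ n) → Prefix.Covered 0 p 2
  base-covered p = List.map (_∷ []) (L v₁) , length≤2 , covers
    where
    open Prefix 0 p
    v₁ : Fin n
    v₁ = emb zero
    length≤2 : length (List.map (_∷ []) (L v₁)) ≤ 2
    length≤2 = begin
      length (List.map (_∷ []) (L v₁)) ≡⟨ length-map _ (L v₁) ⟩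
      length (L v₁)                    ≤⟨ upper v₁ ⟩
      deg isSpine v₁ + 1               ≡⟨ cong (λ v → deg isSpine v + 1) emb-zero ⟩
      deg isSpine first + 1            ≡⟨ cong (_+ 1) first-deg ⟩
      2                                ∎
      where open ≤-Reasoning
    covers : Covers (List.map (_∷ []) (L v₁))
    covers (x ∷ []) ig = lose (∈-map⁺ (_∷ []) (proj₁ (InR₀⇒Valid ig) zero)) (∼-refl ig)

  module Extension (m : ℕ) (p : suc (suc m) ≤ n) (p′ : suc m ≤ n) where

    module Old = Prefix m p′
    module New = Prefix (suc m) p

    new : Fin n
    new = fromℕ< p

    toℕ-new : toℕ new ≡ suc m
    toℕ-new = toℕ-fromℕ< p

    emb-inject₁ : ∀ k → New.emb (inject₁ k) ≡ Old.emb k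
    emb-inject₁ k = toℕ-injective (trans (New.toℕ-emb (inject₁ k)) (trans (toℕ-inject₁ k) (sym (Old.toℕ-emb k))))

    emb-fromℕ : New.emb (fromℕ (suc m)) ≡ new
    emb-fromℕ = toℕ-injective (trans (New.toℕ-emb _) (trans (toℕ-fromℕ (suc m)) (sym toℕ-new)))

    old<new : ∀ k → toℕ (Old.emb k) < toℕ new
    old<new k = subst₂ _<_ (sym (Old.toℕ-emb k)) (sym toℕ-new) (toℕ<n k)

    σ-back : back isSpine (Old.emb Old.σ) new ≡ true
    σ-back = latestSpine⇒back (old<new Old.σ) Old.σ-spine spine-before-new
      where
      spine-before-new : ∀ w → isSpine w ≡ true → toℕ w < toℕ new → toℕ w ≤ toℕ (Old.emb Old.σ)
      spine-before-new w spine w<new = subst₂ _≤_ (toℕ-fromℕ< w<1+m) (sym (Old.toℕ-emb Old.σ))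
                               (Old.σ-maximal (subst (λ u → isSpine u ≡ true) (sym emb-w) spine))
        where
        w<1+m : toℕ w < suc m
        w<1+m = subst (toℕ w <_) toℕ-new w<new
        emb-w : Old.emb (fromℕ< w<1+m) ≡ w
        emb-w = toℕ-injective (trans (Old.toℕ-emb _) (toℕ-fromℕ< w<1+m))

    σ-adj : adj isSpine (Old.emb Old.σ) new ≡ true
    σ-adj rewrite σ-back = refl

    adj-new⇒σ : ∀ {k} → adj isSpine (Old.emb k) new ≡ true → k ≡ Old.σ
    adj-new⇒σ {k} a = Old.emb-injective (back-unique {v = new} (adj⇒back (old<new k) a) σ-back)

    σ-when-spine : isSpine new ≡ true → New.σ ≡ fromℕ (suc m)
    σ-when-spine spine = New.σ-unique (subst (λ u → isSpine u ≡ true) (sym emb-fromℕ) spine) (λ {i} _ → ≤fromℕ i)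

    σ-when-leaf : isSpine new ≡ false → New.σ ≡ inject₁ Old.σ
    σ-when-leaf leaf = New.σ-unique (subst (λ u → isSpine u ≡ true) (sym (emb-inject₁ Old.σ)) Old.σ-spine) maximal
      where
      maximal : ∀ {i} → isSpine (New.emb i) ≡ true → toℕ i ≤ toℕ (inject₁ Old.σ)
      maximal {i} spine with view i
      ... | ‵inject₁ k = subst₂ _≤_ (sym (toℕ-inject₁ k)) (sym (toℕ-inject₁ Old.σ))
                           (Old.σ-maximal (trans (cong isSpine (sym (emb-inject₁ k))) spine))
      ... | ‵fromℕ with () ← trans (sym spine) (trans (cong isSpine emb-fromℕ) leaf)

    σ-colour-when-spine : isSpine new ≡ true → ∀ (g : Old.Colouring) z → lookup (g ∷ʳ z) New.σ ≡ z
    σ-colour-when-spine spine g z rewrite σ-when-spine spine = lookup-∷ʳ-fromℕ g z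

    σ-colour-when-leaf : isSpine new ≡ false → ∀ (g : Old.Colouring) z → lookup (g ∷ʳ z) New.σ ≡ lookup g Old.σ
    σ-colour-when-leaf leaf g z rewrite σ-when-leaf leaf = lookup-∷ʳ-inject₁ g z Old.σ

    degree-sum-∷ʳ : New.degree-sum ≡ Old.degree-sum + deg isSpine new
    degree-sum-∷ʳ = trans (sum-init-last (deg isSpine ∘ New.emb))
                      (cong₂ _+_ (sum-cong-≗ (cong (deg isSpine) ∘ emb-inject₁)) (cong (deg isSpine) emb-fromℕ))

    Extends : Old.Colouring → ℕ → Set
    Extends g z = z ∈ L new × z ≢ lookup g Old.σ

    valid-∷ʳ : ∀ {g z} → Old.Valid g → Extends g z → New.Valid (g ∷ʳ z)
    valid-∷ʳ {g} {z} (in-lists , proper) (z∈L , z≢σ) = in-lists′ , proper′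
      where
      in-lists′ : ∀ j → lookup (g ∷ʳ z) j ∈ L (New.emb j)
      in-lists′ j with view j
      ... | ‵inject₁ k rewrite lookup-∷ʳ-inject₁ g z k | emb-inject₁ k = in-lists k
      ... | ‵fromℕ rewrite lookup-∷ʳ-fromℕ g z | emb-fromℕ = z∈L
      proper′ : ∀ j j′ → adj isSpine (New.emb j) (New.emb j′) ≡ true →
                lookup (g ∷ʳ z) j ≢ lookup (g ∷ʳ z) j′
      proper′ j j′ with view j | view j′
      ... | ‵inject₁ k | ‵inject₁ k′
        rewrite lookup-∷ʳ-inject₁ g z k | lookup-∷ʳ-inject₁ g z k′ | emb-inject₁ k | emb-inject₁ k′ =
        proper k k′
      ... | ‵inject₁ k | ‵fromℕ
        rewrite lookup-∷ʳ-inject₁ g z k | lookup-∷ʳ-fromℕ g z | emb-inject₁ k | emb-fromℕ =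
        λ a gk≡z → z≢σ (trans (sym gk≡z) (cong (lookup g) (adj-new⇒σ a)))
      ... | ‵fromℕ | ‵inject₁ k
        rewrite lookup-∷ʳ-inject₁ g z k | lookup-∷ʳ-fromℕ g z | emb-inject₁ k | emb-fromℕ =
        λ a z≡gk → z≢σ (trans z≡gk (cong (lookup g) (adj-new⇒σ (trans (adj-sym (Old.emb k) new) a))))
      ... | ‵fromℕ | ‵fromℕ rewrite emb-fromℕ = λ a → ⊥-elim (adj-irrefl new a)

    valid-∷ʳ⁻ : ∀ {g z} → New.Valid (g ∷ʳ z) → Old.Valid g × Extends g z
    valid-∷ʳ⁻ {g} {z} (in-lists , proper) = (in-lists′ , proper′) , z∈L , z≢σ
      where
      in-lists′ : ∀ k → lookup g k ∈ L (Old.emb k)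
      in-lists′ k = subst₂ (λ c u → c ∈ L u) (lookup-∷ʳ-inject₁ g z k) (emb-inject₁ k) (in-lists (inject₁ k))
      proper′ : ∀ k k′ → adj isSpine (Old.emb k) (Old.emb k′) ≡ true → lookup g k ≢ lookup g k′
      proper′ k k′ a gk≡gk′ =
        proper (inject₁ k) (inject₁ k′)
          (subst₂ (λ u u′ → adj isSpine u u′ ≡ true) (sym (emb-inject₁ k)) (sym (emb-inject₁ k′)) a)
          (trans (lookup-∷ʳ-inject₁ g z k) (trans gk≡gk′ (sym (lookup-∷ʳ-inject₁ g z k′))))
      z∈L : z ∈ L new
      z∈L = subst₂ (λ c u → c ∈ L u) (lookup-∷ʳ-fromℕ g z) emb-fromℕ (in-lists (fromℕ (suc m)))
      z≢σ : z ≢ lookup g Old.σ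
      z≢σ z≡gσ =
        proper (fromℕ (suc m)) (inject₁ Old.σ)
          (subst₂ (λ u u′ → adj isSpine u u′ ≡ true) (sym emb-fromℕ) (sym (emb-inject₁ Old.σ))
            (trans (adj-sym new (Old.emb Old.σ)) σ-adj))
          (trans (lookup-∷ʳ-fromℕ g z) (trans z≡gσ (sym (lookup-∷ʳ-inject₁ g z Old.σ))))

    DiffOne-∷ʳ : ∀ {g h} z → Old.DiffOne g h → New.DiffOne (g ∷ʳ z) (h ∷ʳ z)
    DiffOne-∷ʳ {g} {h} z (k , differ , agree) = inject₁ k , differ′ , agree′
      where
      differ′ : lookup (g ∷ʳ z) (inject₁ k) ≢ lookup (h ∷ʳ z) (inject₁ k)
      differ′ rewrite lookup-∷ʳ-inject₁ g z k | lookup-∷ʳ-inject₁ h z k = differ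
      agree′ : ∀ j → j ≢ inject₁ k → lookup (g ∷ʳ z) j ≡ lookup (h ∷ʳ z) j
      agree′ j j≢k with view j
      ... | ‵inject₁ k′ rewrite lookup-∷ʳ-inject₁ g z k′ | lookup-∷ʳ-inject₁ h z k′ =
        agree k′ (j≢k ∘ cong inject₁)
      ... | ‵fromℕ rewrite lookup-∷ʳ-fromℕ g z | lookup-∷ʳ-fromℕ h z = refl

    DiffOne-last : ∀ g {z z′} → z ≢ z′ → New.DiffOne (g ∷ʳ z) (g ∷ʳ z′)
    DiffOne-last g {z} {z′} z≢z′ = fromℕ (suc m) , differ , agree
      where
      differ : lookup (g ∷ʳ z) (fromℕ (suc m)) ≢ lookup (g ∷ʳ z′) (fromℕ (suc m))
      differ rewrite lookup-∷ʳ-fromℕ g z | lookup-∷ʳ-fromℕ g z′ = z≢z′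
      agree : ∀ j → j ≢ fromℕ (suc m) → lookup (g ∷ʳ z) j ≡ lookup (g ∷ʳ z′) j
      agree j j≢last with view j
      ... | ‵inject₁ k rewrite lookup-∷ʳ-inject₁ g z k | lookup-∷ʳ-inject₁ g z′ k = refl
      ... | ‵fromℕ = ⊥-elim (j≢last refl)

    DiffOne-∷ʳ⁻ : ∀ {g h z z′} → New.DiffOne (g ∷ʳ z) (h ∷ʳ z′) → Old.DiffOne g h ⊎ g ≡ h
    DiffOne-∷ʳ⁻ {g} {h} {z} {z′} (j , differ , agree) with view j
    ... | ‵inject₁ k = inj₁ (k , differ′ , agree′)
      where
      differ′ : lookup g k ≢ lookup h k
      differ′ gk≡hk = differ (trans (lookup-∷ʳ-inject₁ g z k) (trans gk≡hk (sym (lookup-∷ʳ-inject₁ h z′ k))))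
      agree′ : ∀ k′ → k′ ≢ k → lookup g k′ ≡ lookup h k′
      agree′ k′ k′≢k = trans (sym (lookup-∷ʳ-inject₁ g z k′))
                         (trans (agree (inject₁ k′) (k′≢k ∘ inject₁-injective)) (lookup-∷ʳ-inject₁ h z′ k′))
    ... | ‵fromℕ = inj₂ (lookup-extensional λ k →
            trans (sym (lookup-∷ʳ-inject₁ g z k))
              (trans (agree (inject₁ k) (fromℕ≢inject₁ ∘ sym)) (lookup-∷ʳ-inject₁ h z′ k)))

    step-∷ʳ : ∀ {g h z} → Old.Step g h → Extends g z → Extends h z → New.Step (g ∷ʳ z) (h ∷ʳ z)
    step-∷ʳ {g} {h} {z} (vg , vh , d) eg eh = valid-∷ʳ {g} vg eg , valid-∷ʳ {h} vh eh , DiffOne-∷ʳ {g} {h} z d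

    step-last : ∀ {g z z′} → Old.Valid g → Extends g z → Extends g z′ → z ≢ z′ →
                New.Step (g ∷ʳ z) (g ∷ʳ z′)
    step-last {g} vg e e′ z≢z′ = valid-∷ʳ {g} vg e , valid-∷ʳ {g} vg e′ , DiffOne-last g z≢z′

    step-∷ʳ⁻ : ∀ {g h z z′} → New.Step (g ∷ʳ z) (h ∷ʳ z′) → Old.Step g h ⊎ g ≡ h
    step-∷ʳ⁻ {g} {h} {z} {z′} (vg , vh , d) with DiffOne-∷ʳ⁻ {g} {h} {z} {z′} d
    ... | inj₁ d′ = inj₁ (proj₁ (valid-∷ʳ⁻ {g} {z} vg) , proj₁ (valid-∷ʳ⁻ {h} {z′} vh) , d′)
    ... | inj₂ g≡h = inj₂ g≡h

    step-init : ∀ {q q′} → New.Step q q′ → Old.Step (init q) (init q′) ⊎ init q ≡ init q′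
    step-init {q} {q′} s with initLast q | initLast q′
    ... | g , z , refl | g′ , z′ , refl = step-∷ʳ⁻ {g} {g′} {z} {z′} s

    Star-init : ∀ {q q′} → Star New.Step q q′ → Star Old.Step (init q) (init q′)
    Star-init ε = ε
    Star-init {q} {q′} (_◅_ {j = q₁} s walk) with step-init {q} {q₁} s
    ... | inj₁ s′ = s′ ◅ Star-init walk
    ... | inj₂ same = subst (λ g → Star Old.Step g (init q′)) (sym same) (Star-init walk)

    f₀↾-∷ʳ : New.f₀↾ ≡ Old.f₀↾ ∷ʳ f₀ new
    f₀↾-∷ʳ = trans (tabulate-∷ʳ (f₀ ∘ New.emb))
                   (cong₂ _∷ʳ_ (tabulate-cong (cong f₀ ∘ emb-inject₁)) (cong f₀ emb-fromℕ))

    InR₀-∷ʳ⁻ : ∀ {g z} → New.InR₀ (g ∷ʳ z) → Old.InR₀ g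
    InR₀-∷ʳ⁻ {g} {z} walk =
      subst₂ (Star Old.Step) (trans (cong init f₀↾-∷ʳ) (init-∷ʳ (f₀ new) Old.f₀↾)) (init-∷ʳ z g)
        (Star-init walk)

    covers-∷ʳ : ∀ {ys} →
                (∀ {g z} → Old.InR₀ g → Extends g z → New.InR₀ (g ∷ʳ z) → Any ((g ∷ʳ z) New.∼_) ys) →
                New.Covers ys
    covers-∷ʳ cover q iq with initLast q
    ... | g , z , refl = cover (InR₀-∷ʳ⁻ {g} {z} iq) (proj₂ (valid-∷ʳ⁻ {g} {z} (New.InR₀⇒Valid iq))) iq

    Walk-∷ʳ : ∀ {C C′ : ℕ → Set} {g h z} → z ∈ L new → (∀ {x} → C x → z ≢ x) →
              (∀ {a} → C (lookup a Old.σ) → C′ (lookup (a ∷ʳ z) New.σ)) →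
              Old.Walk C g h → New.Walk C′ (g ∷ʳ z) (h ∷ʳ z)
    Walk-∷ʳ {z = z} z∈L avoid transfer =
      gmap (_∷ʳ z) λ {a} {b} (s , ca , cb) →
        step-∷ʳ {a} {b} s (z∈L , avoid ca) (z∈L , avoid cb) , transfer {a} ca , transfer {b} cb

    leaf-∼ : isSpine new ≡ false → ∀ {g y z z′} → Extends g z → Extends y z′ → New.InR₀ (g ∷ʳ z) →
             g Old.∼ y → (g ∷ʳ z) New.∼ (y ∷ʳ z′)
    leaf-∼ leaf {g} {y} {z} {z′} (z∈L , z≢gσ) e′ ig′ g∼y =
      New.∼-intro ig′ (subst (λ c → New.Walk (_≡ c) (g ∷ʳ z) (y ∷ʳ z′)) (sym (σ-colour-when-leaf leaf g z)) walk)
      where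
      colour : ∀ a x → lookup a Old.σ ≡ lookup g Old.σ → lookup (a ∷ʳ x) New.σ ≡ lookup g Old.σ
      colour a x aσ≡gσ = trans (σ-colour-when-leaf leaf a x) aσ≡gσ
      lifted : New.Walk (_≡ lookup g Old.σ) (g ∷ʳ z) (y ∷ʳ z)
      lifted = Walk-∷ʳ {C = _≡ lookup g Old.σ} {C′ = _≡ lookup g Old.σ} z∈L
                 (λ x≡gσ z≡x → z≢gσ (trans z≡x x≡gσ)) (λ {a} → colour a z) (Old.∼⇒Walk g∼y)
      yσ≡gσ : lookup y Old.σ ≡ lookup g Old.σ
      yσ≡gσ = sym (Old.∼-colour g∼y)
      walk : New.Walk (_≡ lookup g Old.σ) (g ∷ʳ z) (y ∷ʳ z′)
      walk with z ℕ.≟ z′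
      ... | yes z≡z′ = subst (λ x → New.Walk (_≡ lookup g Old.σ) (g ∷ʳ z) (y ∷ʳ x)) z≡z′ lifted
      ... | no z≢z′ = lifted ◅◅ (recolour , colour y z yσ≡gσ , colour y z′ yσ≡gσ) ◅ ε
        where
        recolour : New.Step (y ∷ʳ z) (y ∷ʳ z′)
        recolour = step-last {y} (Old.InR₀⇒Valid (Old.∼⇒InR₀ g∼y))
                     (z∈L , λ z≡yσ → z≢gσ (trans z≡yσ yσ≡gσ)) e′ z≢z′

    spine-∼ : isSpine new ≡ true → ∀ {g h z} → z ∈ L new → New.InR₀ (g ∷ʳ z) →
              Old.Walk (z ≢_) g h → (g ∷ʳ z) New.∼ (h ∷ʳ z)
    spine-∼ spine {g} {h} {z} z∈L ig′ walk =
      New.∼-intro ig′ (subst (λ c → New.Walk (_≡ c) (g ∷ʳ z) (h ∷ʳ z)) (sym (σ-colour-when-spine spine g z))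
        (Walk-∷ʳ {C = z ≢_} {C′ = _≡ z} z∈L id (λ {a} _ → σ-colour-when-spine spine a z) walk))

    leaf-covered : isSpine new ≡ false → ∀ {c} → Old.EncodingSize c → New.Covered c
    leaf-covered leaf (xs , refl , _ , _ , cover) =
      List.map extend xs , ≤-reflexive (length-map extend xs) , covers-∷ʳ represented
      where
      fresh : ∀ y → ∃[ z ] Extends y z
      fresh y = other-member (unique new) (lower new) (lookup y Old.σ)
      extend : Old.Colouring → New.Colouring
      extend y = y ∷ʳ proj₁ (fresh y)
      represented : ∀ {g z} → Old.InR₀ g → Extends g z → New.InR₀ (g ∷ʳ z) →
                    Any ((g ∷ʳ z) New.∼_) (List.map extend xs)
      represented {g} ig e ig′ = map⁺ (Any.map (λ {y} → leaf-∼ leaf e (proj₂ (fresh y)) ig′) (cover g ig))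

    module SpineCover (spine : isSpine new ≡ true) {xs : List Old.Colouring}
      (In-xs : All Old.InR₀ xs) (ineq : Old.Inequivalent xs) (cover : Old.Covers xs) where

      Class : Set
      Class = Fin (length xs)

      rep : Class → Old.Colouring
      rep = List.lookup xs

      κ : Class → ℕ
      κ t = lookup (rep t) Old.σ

      rep-InR₀ : ∀ t → Old.InR₀ (rep t)
      rep-InR₀ t = All.lookup In-xs (∈-lookup t)

      class : ∀ {g} → Old.InR₀ g → Class
      class ig = index (cover _ ig)

      ∼-class : ∀ {g} (ig : Old.InR₀ g) → g Old.∼ rep (class ig)
      ∼-class ig = lookup-index (cover _ ig)

      class-unique : ∀ {t t′} → rep t Old.∼ rep t′ → t ≡ t′
      class-unique {t} {t′} t∼t′ with <ᶠ-cmp t t′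
      ... | tri< t<t′ _ _ = ⊥-elim (AllPairs-lookup ineq t<t′ t∼t′)
      ... | tri≈ _ t≡t′ _ = t≡t′
      ... | tri> _ _ t′<t = ⊥-elim (AllPairs-lookup ineq t′<t (Old.∼-sym t∼t′))

      root : Class
      root = class {Old.f₀↾} ε

      Adjacent : Class → Class → Set
      Adjacent t t′ = ∃[ g ] ∃[ g′ ] g Old.∼ rep t × g′ Old.∼ rep t′ × Old.Step g g′

      Reached : Old.Colouring → Set
      Reached g = ∀ t → g Old.∼ rep t → Star Adjacent root t

      reached-along : ∀ {g h} → Star Old.Step g h → Old.InR₀ g → Reached g → Reached h
      reached-along ε _ reached = reached
      reached-along {g} (_◅_ {j = g₁} s walk) ig reached = reached-along walk (ig ◅◅ s ◅ ε) reached₁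
        where
        reached₁ : Reached g₁
        reached₁ t g₁∼t = reached (class ig) (∼-class ig) ◅◅ (g , g₁ , ∼-class ig , g₁∼t , s) ◅ ε

      connected : ∀ t → Star Adjacent root t
      connected t = reached-along (rep-InR₀ t) ε reached-f₀ t (Old.∼-refl (rep-InR₀ t))
        where
        reached-f₀ : Reached Old.f₀↾
        reached-f₀ t f₀∼t = subst (Star Adjacent root) (class-unique (Old.∼-trans (Old.∼-sym (∼-class ε)) f₀∼t)) ε

      ¬¬-Adjacent? : ¬ ¬ (∀ t t′ → Dec (Adjacent t t′))
      ¬¬-Adjacent? = ¬¬-Π λ t → ¬¬-Π λ t′ → ¬¬-excluded-middle

      module Representatives (Adjacent? : ∀ t t′ → Dec (Adjacent t t′)) where

        open BreadthFirstTree Adjacent Adjacent? root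
        open Tree connected

        top : Class → New.Colouring
        top t = rep t ∷ʳ κ (parent t)

        non-root : List Class
        non-root = proj₁ (allFin-except root)

        ys : List New.Colouring
        ys = List.map top non-root ++ List.map (rep root ∷ʳ_) (L new)

        length-ys : length ys ≤ length xs + deg isSpine new
        length-ys = begin
          length ys                                 ≡⟨ length-++ (List.map top non-root) ⟩
          length (List.map top non-root) + length (List.map (rep root ∷ʳ_) (L new))
                                                    ≡⟨ cong₂ _+_ (length-map top non-root) (length-map _ (L new)) ⟩
          length non-root + length (L new)          ≤⟨ +-monoʳ-≤ (length non-root) (upper new) ⟩
          length non-root + (deg isSpine new + 1)   ≡⟨ cong (length non-root +_) (+-comm (deg isSpine new) 1) ⟩
          length non-root + suc (deg isSpine new)   ≡⟨ +-suc (length non-root) (deg isSpine new) ⟩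
          suc (length non-root) + deg isSpine new   ≡⟨ cong (_+ deg isSpine new) (proj₁ (proj₂ (allFin-except root))) ⟩
          length xs + deg isSpine new               ∎
          where open ≤-Reasoning

        module _ {z : ℕ} where

          Avoids : Class → Set
          Avoids t = z ≢ κ t

          up-walk : ∀ {a b} → Up Avoids a b → Old.Walk (z ≢_) (rep a) (rep b)
          up-walk {a} {b} ((h , h′ , h∼b , h′∼a , s) , za , zb) =
            Old.∼⇒Walk-avoiding (Old.∼-sym h′∼a) za ◅◅
            (Old.Step-sym {h} {h′} s , z≢h′σ , z≢hσ) ◅
            Old.∼⇒Walk-avoiding h∼b z≢hσ
            where
            z≢h′σ : z ≢ lookup h′ Old.σ
            z≢h′σ z≡ = za (trans z≡ (Old.∼-colour h′∼a))
            z≢hσ : z ≢ lookup h Old.σ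
            z≢hσ z≡ = zb (trans z≡ (Old.∼-colour h∼b))

          climb-walk : ∀ {a b} → Star (Up Avoids) a b → Old.Walk (z ≢_) (rep a) (rep b)
          climb-walk ε = ε
          climb-walk (up ◅ ups) = up-walk up ◅◅ climb-walk ups

          top-member : ∀ {t} → z ∈ L new → t ≡ root ⊎ ¬ Avoids (parent t) → rep t ∷ʳ z ∈ ys
          top-member {t} z∈L stop = member (t ≟ root) stop
            where
            member : Dec (t ≡ root) → t ≡ root ⊎ ¬ Avoids (parent t) → rep t ∷ʳ z ∈ ys
            member (yes refl) _ = ∈-++⁺ʳ (List.map top non-root) (∈-map⁺ (rep root ∷ʳ_) z∈L)
            member (no t≢root) (inj₁ t≡root) = ⊥-elim (t≢root t≡root)
            member (no t≢root) (inj₂ ¬avoids) =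
              ∈-++⁺ˡ (subst (λ x → rep t ∷ʳ x ∈ List.map top non-root)
                            (sym (decidable-stable (z ℕ.≟ κ (parent t)) ¬avoids))
                            (∈-map⁺ top (proj₂ (proj₂ (allFin-except root)) t≢root)))

          represented : ∀ {g} → Old.InR₀ g → Extends g z → New.InR₀ (g ∷ʳ z) → Any ((g ∷ʳ z) New.∼_) ys
          represented {g} ig (z∈L , z≢gσ) ig′ =
            let t , ups , stop = climb (λ t → ¬? (z ℕ.≟ κ t))
                                       (λ z≡ → z≢gσ (trans z≡ (sym (Old.∼-colour (∼-class ig)))))
            in lose (top-member z∈L stop)
                    (spine-∼ spine z∈L ig′ (Old.∼⇒Walk-avoiding (∼-class ig) z≢gσ ◅◅ climb-walk ups))

        covered : New.Covered (length xs + deg isSpine new)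
        covered = ys , length-ys , covers-∷ʳ represented

    spine-covered : isSpine new ≡ true → ∀ {c} → Old.EncodingSize c → ¬ ¬ New.Covered (c + deg isSpine new)
    spine-covered spine (_ , refl , In-xs , ineq , cover) = do
      Adjacent? ← ¬¬-Adjacent?
      return (Representatives.covered Adjacent?)
      where open SpineCover spine In-xs ineq cover

    ¬¬-covered : ∀ {c} → Old.EncodingSize c → ¬ ¬ New.Covered (c + deg isSpine new)
    ¬¬-covered {c} size = by-kind (isSpine new) refl
      where
      by-kind : ∀ b → isSpine new ≡ b → ¬ ¬ New.Covered (c + deg isSpine new)
      by-kind true spine = spine-covered spine size
      by-kind false leaf = return (New.Covered-weaken (m≤m+n c _) (leaf-covered leaf size))

  base-bound : (p : 1 ≤ n) (c : ℕ) → NodeCount isSpine L f₀ 0 p c → c ≤ 2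
  base-bound p _ size = Prefix.size≤cover 0 p size (base-covered p)

  step-bound : ∀ m (p : suc (suc m) ≤ n) (p′ : suc m ≤ n) (c c′ : ℕ) →
               NodeCount isSpine L f₀ (suc m) p c → NodeCount isSpine L f₀ m p′ c′ →
               c ≤ c′ + deg isSpine (fromℕ< p)
  step-bound m p p′ c c′ size size′ =
    decidable-stable (c ≤? c′ + deg isSpine new) (New.size≤cover size <$> ¬¬-covered size′)
    where open Extension m p p′

  ¬¬-bounded-size : ∀ m (p : suc m ≤ n) → ¬ ¬ (∃[ c ] Prefix.EncodingSize m p c × c ≤ 2 + Prefix.degree-sum m p)
  ¬¬-bounded-size zero p = do
    c , size , c≤2 ← Prefix.¬¬-size 0 p (base-covered p)
    return (c , size , ≤-trans c≤2 (m≤m+n 2 _))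
  ¬¬-bounded-size (suc m) p = do
    c′ , size′ , c′≤ ← ¬¬-bounded-size m p′
    covered ← ¬¬-covered size′
    c , size , c≤ ← New.¬¬-size covered
    return (c , size , (begin
      c                                        ≤⟨ c≤ ⟩
      c′ + deg isSpine new                     ≤⟨ +-monoˡ-≤ (deg isSpine new) c′≤ ⟩
      2 + Old.degree-sum + deg isSpine new     ≡⟨ +-assoc 2 Old.degree-sum (deg isSpine new) ⟩
      2 + (Old.degree-sum + deg isSpine new)   ≡⟨ cong (2 +_) degree-sum-∷ʳ ⟨
      2 + New.degree-sum                       ∎))
    where
    p′ : suc m ≤ n
    p′ = ≤-trans (n≤1+n (suc m)) p
    open Extension m p p′
    open ≤-Reasoning

  size-linear : ∀ m (p : suc m ≤ n) (c : ℕ) → NodeCount isSpine L f₀ m p c → c ≤ 4 * n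
  size-linear m p c size = decidable-stable (c ≤? 4 * n) do
    c′ , size′ , c′≤ ← ¬¬-bounded-size m p
    return (begin
      c                          ≤⟨ Prefix.size≤cover m p size (Prefix.size-covered m p size′) ⟩
      c′                         ≤⟨ c′≤ ⟩
      2 + Prefix.degree-sum m p  ≤⟨ +-monoʳ-≤ 2 (≤-trans (∑-inject≤ (deg isSpine) p) handshake) ⟩
      2 + (n + n)                ≤⟨ +-monoˡ-≤ (n + n) (+-mono-≤ 1≤n 1≤n) ⟩
      (n + n) + (n + n)          ≡⟨ four-times n ⟨
      4 * n                      ∎)
    where
    open ≤-Reasoning
    1≤n : 1 ≤ n
    1≤n = ≤-trans (s≤s z≤n) p
    four-times : ∀ k → 4 * k ≡ (k + k) + (k + k)
    four-times = solve-∀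

lemma7 : Σ ℕ λ C →
    ∀ (n : ℕ) (isSpine : Fin n → Bool) (L : Fin n → List ℕ) (f₀ : Fin n → ℕ) →
    IsBFSCaterpillar isSpine → AdmissibleLists isSpine L → IsListColouring isSpine L f₀ →
    (∀ (p : 1 ≤ n) (c : ℕ) → NodeCount isSpine L f₀ 0 p c → c ≤ 2)
    × (∀ (m : ℕ) (p : suc (suc m) ≤ n) (p' : suc m ≤ n) (c c' : ℕ) →
         NodeCount isSpine L f₀ (suc m) p c → NodeCount isSpine L f₀ m p' c' →
         c ≤ c' + deg isSpine (fromℕ< p))
    × (∀ (m : ℕ) (p : suc m ≤ n) → suc m ≡ n → (c : ℕ) →
         NodeCount isSpine L f₀ m p c → c ≤ C * n)
lemma7 = 4 , λ n isSpine L f₀ caterpillar lists f₀-colouring →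
  let open Reconfiguration isSpine L f₀ caterpillar lists f₀-colouring in
  -- size-linear holds for every prefix
  base-bound , step-bound , λ m p _ → size-linear m p
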